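{- Let $n,d\ge1$ be integers, $p$ a prime with $p\nmid d$, and $j\in\{0,1,\dots,nd\}$. If $(p-1)j\equiv0\pmod d$, then $h_{j,1}=0$.
   Context: For $j\in\mathbb Z$ let $h_j=\#\{u\in\{1,\dots,d-1\}^n : u_1+\cdots+u_n=j\}$ (so $h_j=0$ unless $0\le j\le nd$). For an integer $m\le nd$ let $H_m=\sum_{t\ge0}h_{m-td}$ (so $H_m=0$ for $m<0$). For $j\in\{0,\dots,nd\}$ let $\sigma_j(0)$ be the unique integer with $j-\sigma_j(0)\equiv p^{ -1}j\pmod d$ ($p^{ -1}$ the inverse of $p$ mod $d$) lying in $\{0,\dots,d-1\}$ if $(p-1)j\not\equiv0\pmod d$ and in $\{1,\dots,d\}$ if $(p-1)j\equiv0\pmod d$. The Frobenius numbers are $h_{j,0}=H_j-H_{j-\sigma_j(0)}$ and $h_{j,1}=H_{j-\sigma_j(0)}-H_{j-d}$. -}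

module Defs where

open import Data.Nat as ℕ using (ℕ; zero; suc)
open import Data.Integer as ℤ using (ℤ; +_; -[1+_])
open import Data.Integer.Divisibility using (_∣_)
open import Data.List using (List; []; _∷_; map; concatMap; filter; length; upTo)
open import Data.Nat.ListAction using (sum)
open import Data.Vec using (Vec; []; _∷_)
import Data.Vec as Vec
open import Data.Product using (_×_)
open import Data.Sum using (_⊎_)
open import Relation.Nullary using (¬_)
open import Relation.Binary.PropositionalEquality using (_≡_)

box : (n d : ℕ) → List (Vec ℕ n)
box zero    d = [] ∷ []
box (suc n) d = concatMap (λ a → map (a ∷_) (box n d)) (map suc (upTo (d ℕ.∸ 1)))

hN : (n d j : ℕ) → ℕ
hN n d j = length (filter (λ u → Vec.sum u ℕ.≟ j) (box n d))

h : (n d : ℕ) → ℤ → ℕ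
h n d (+ j)    = hN n d j
h n d -[1+ _ ] = 0

-- H_m = Σ_{t ≥ 0} h_{m - t d}; for m = k ≥ 0 and d ≥ 1 only t ≤ k can contribute,
-- for m < 0 it is 0.
H : (n d : ℕ) → ℤ → ℕ
H n d (+ k)    = sum (map (λ t → h n d (+ k ℤ.- + (t ℕ.* d))) (upTo (suc k)))
H n d -[1+ _ ] = 0

_≡_[mod_] : ℤ → ℤ → ℕ → Set
a ≡ b [mod d ] = (+ d) ∣ (a ℤ.- b)

IsInvMod : (p d : ℕ) → ℤ → Set
IsInvMod p d q = (+ p ℤ.* q) ≡ ℤ.1ℤ [mod d ]

-- σ is σ_j(0): j - σ ≡ p^{-1} j (mod d), with σ ∈ {1..d} if (p-1)j ≡ 0 (mod d)
-- and σ ∈ {0..d-1} otherwise.  (q stands for p^{-1} mod d.)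
IsSigma0 : (p d j : ℕ) (q σ : ℤ) → Set
IsSigma0 p d j q σ =
  ((+ j ℤ.- σ) ≡ q ℤ.* + j [mod d ]) ×
  (( ((+ ((p ℕ.∸ 1) ℕ.* j)) ≡ ℤ.0ℤ [mod d ]) × (ℤ.1ℤ ℤ.≤ σ) × (σ ℤ.≤ + d))
   ⊎ ((¬ ((+ ((p ℕ.∸ 1) ℕ.* j)) ≡ ℤ.0ℤ [mod d ])) × (ℤ.0ℤ ℤ.≤ σ) × (σ ℤ.≤ + d ℤ.- ℤ.1ℤ)))

h₁ : (n d j : ℕ) (σ : ℤ) → ℤ
h₁ n d j σ = + H n d (+ j ℤ.- σ) ℤ.- + H n d (+ j ℤ.- + d)

module Submission where

-- When (p-1)j ≡ 0 (mod d) we have pj ≡ j, hence p⁻¹j ≡ p⁻¹pj ≡ j (mod d).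
-- The defining congruence j - σ ≡ p⁻¹j of σ = σ_j(0) then forces d ∣ σ,
-- and since in this case σ ∈ {1,…,d}, the only possibility is σ = d.
-- But then h_{j,1} = H_{j-σ} - H_{j-d} is a difference of two equal numbers.

open import Defs
open import Data.Nat using (ℕ; _≤_; _*_; _∸_)
open import Data.Nat.Divisibility using (_∣_)
open import Data.Nat.Primality using (Prime)
open import Data.Integer using (ℤ; +_; 0ℤ)
open import Relation.Nullary using (¬_)
open import Relation.Binary.PropositionalEquality using (_≡_)

import Data.Nat as ℕ
import Data.Nat.Properties as ℕP
import Data.Nat.Divisibility as ℕD
open import Data.Nat.Primality using (prime⇒nonZero)
import Data.Integer as ℤ
import Data.Integer.Properties as ℤP
open import Data.Integer.Divisibility.Signed as Signed
  using (∣ᵤ⇒∣; ∣⇒∣ᵤ; ∣m∣n⇒∣m-n; ∣m⇒∣m*n; ∣n⇒∣m*n)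
open import Data.Integer.Solver using (module +-*-Solver)
open import Data.Product using (_,_)
open import Data.Sum using (inj₁; inj₂)
open import Data.Empty using (⊥-elim)
open import Relation.Binary.PropositionalEquality using (refl; cong; subst; sym)

congruent-zero⇒∣ : ∀ {d} (a : ℤ) → a ≡ 0ℤ [mod d ] → + d Signed.∣ a
congruent-zero⇒∣ a d∣a-0 = subst (_ Signed.∣_) (ℤP.+-identityʳ a) (∣ᵤ⇒∣ d∣a-0)

-- If q is an inverse of P modulo k, it fixes every J that P fixes:
-- J - qJ = q·((P-1)J) - (Pq-1)·J.
inverse-fixes-fixed-points : ∀ (k P q J : ℤ) →
  k Signed.∣ P ℤ.* q ℤ.- ℤ.1ℤ → k Signed.∣ (P ℤ.- ℤ.1ℤ) ℤ.* J →
  k Signed.∣ J ℤ.- q ℤ.* J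
inverse-fixes-fixed-points k P q J k∣Pq-1 k∣[P-1]J =
  subst (k Signed.∣_) (identity P q J)
        (∣m∣n⇒∣m-n (∣n⇒∣m*n q k∣[P-1]J) (∣m⇒∣m*n J k∣Pq-1))
  where
  open +-*-Solver
  identity : ∀ P q J →
    q ℤ.* ((P ℤ.- ℤ.1ℤ) ℤ.* J) ℤ.- (P ℤ.* q ℤ.- ℤ.1ℤ) ℤ.* J ≡ J ℤ.- q ℤ.* J
  identity = solve 3 (λ P q J →
    q :* ((P :- con ℤ.1ℤ) :* J) :- (P :* q :- con ℤ.1ℤ) :* J := J :- q :* J) refl

-- If J - σ ≡ qJ and q fixes J, then σ ≡ 0: σ = (J - qJ) - ((J - σ) - qJ).
sigma-divisible : ∀ (k P q J σ : ℤ) →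
  k Signed.∣ P ℤ.* q ℤ.- ℤ.1ℤ → k Signed.∣ (P ℤ.- ℤ.1ℤ) ℤ.* J →
  k Signed.∣ (J ℤ.- σ) ℤ.- q ℤ.* J → k Signed.∣ σ
sigma-divisible k P q J σ k∣Pq-1 k∣[P-1]J k∣[J-σ]-qJ =
  subst (k Signed.∣_) (identity q J σ)
        (∣m∣n⇒∣m-n (inverse-fixes-fixed-points k P q J k∣Pq-1 k∣[P-1]J) k∣[J-σ]-qJ)
  where
  open +-*-Solver
  identity : ∀ q J σ → (J ℤ.- q ℤ.* J) ℤ.- ((J ℤ.- σ) ℤ.- q ℤ.* J) ≡ σ
  identity = solve 3 (λ q J σ → (J :- q :* J) :- ((J :- σ) :- q :* J) := σ) refl

multiple-in-range : ∀ {d} (σ : ℤ) → + d Signed.∣ σ → ℤ.1ℤ ℤ.≤ σ → σ ℤ.≤ + d → σ ≡ + d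
multiple-in-range (+ ℕ.zero) _ (ℤ.+≤+ ()) _
multiple-in-range (+ ℕ.suc s) d∣σ _ (ℤ.+≤+ s<d) =
  cong +_ (ℕP.≤-antisym s<d (ℕD.∣⇒≤ (∣⇒∣ᵤ d∣σ)))

h₁-at-d : ∀ n d j → h₁ n d j (+ d) ≡ 0ℤ
h₁-at-d n d j = ℤP.+-inverseʳ (+ H n d (+ j ℤ.- + d))

mainTheorem7 : (n d p j : ℕ) → 1 ≤ n → 1 ≤ d → Prime p → ¬ (p ∣ d) → j ≤ n * d →
    (q : ℤ) → IsInvMod p d q →
    (σ : ℤ) → IsSigma0 p d j q σ →
    (+ ((p ∸ 1) * j)) ≡ 0ℤ [mod d ] →
    h₁ n d j σ ≡ 0ℤ
mainTheorem7 n d ℕ.zero j _ _ p-prime _ _ _ _ _ _ _ with prime⇒nonZero p-prime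
... | ()
mainTheorem7 n d (ℕ.suc p') j _ _ _ _ _ q _ σ (_ , inj₂ (p-does-not-fix-j , _)) p-fixes-j =
  ⊥-elim (p-does-not-fix-j p-fixes-j)
mainTheorem7 n d (ℕ.suc p') j _ _ _ _ _ q q-inverts-p σ (σ-cong , inj₁ (_ , 1≤σ , σ≤d)) p-fixes-j =
  subst (λ s → h₁ n d j s ≡ 0ℤ) (sym σ≡d) (h₁-at-d n d j)
  where
  d∣[p-1]j : + d Signed.∣ (+ ℕ.suc p' ℤ.- ℤ.1ℤ) ℤ.* + j
  d∣[p-1]j = subst (+ d Signed.∣_) (ℤP.pos-* p' j)
                   (congruent-zero⇒∣ (+ (p' * j)) p-fixes-j)
  σ≡d : σ ≡ + d
  σ≡d = multiple-in-range σ
          (sigma-divisible (+ d) (+ ℕ.suc p') q (+ j) σ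
             (∣ᵤ⇒∣ q-inverts-p) d∣[p-1]j (∣ᵤ⇒∣ σ-cong))
          1≤σ σ≤d
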